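{- For every $n\in\mathbb{N}$, the graph $G(3,n)$ is connected and has diameter at most $3$.
   Context: For a prime $p$ and $n\in\mathbb{N}$, $G(p,n)$ is the simple graph with vertex set $\{2,4,\ldots,2n\}$ in which two distinct vertices $a,b$ are adjacent if and only if both $\frac{a+b}{2}$ and $\frac{|a-b|}{2}$ are odd positive integers neither of which equals $pk$ for an integer $k\ge 2$. -}

module Defs where

open import Data.Nat using (ℕ; zero; suc; _+_; _*_; _≤_; _<_; ⌊_/2⌋; ∣_-_∣)
open import Data.Product using (Σ; ∃; _×_; _,_)
open import Relation.Binary.PropositionalEquality using (_≡_; _≢_)
open import Relation.Nullary using (¬_)

Odd : ℕ → Set
Odd m = ∃ λ k → m ≡ 1 + 2 * k

BadMultiple : ℕ → ℕ → Set
BadMultiple p m = ∃ λ k → 2 ≤ k × m ≡ p * k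

Allowed : ℕ → ℕ → Set
Allowed p m = Odd m × 0 < m × ¬ BadMultiple p m

IsVertex : ℕ → ℕ → Set
IsVertex n a = ∃ λ k → 1 ≤ k × k ≤ n × a ≡ 2 * k

-- adjacency in G(p,n) (for vertices a, b; both are even so the halves are exact)
Adj : ℕ → ℕ → ℕ → ℕ → Set
Adj p n a b =
  IsVertex n a × IsVertex n b × a ≢ b ×
  Allowed p ⌊ (a + b) /2⌋ × Allowed p ⌊ ∣ a - b ∣ /2⌋

data Walk (p n : ℕ) : ℕ → ℕ → ℕ → Set where
  here : ∀ {a} → Walk p n a a 0
  step : ∀ {a b c ℓ} → Adj p n a b → Walk p n b c ℓ → Walk p n a c (suc ℓ)

Connected : ℕ → ℕ → Set
Connected p n = ∀ a b → IsVertex n a → IsVertex n b → ∃ λ ℓ → Walk p n a b ℓ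

DiameterAtMost : ℕ → ℕ → ℕ → Set
DiameterAtMost p n d =
  ∀ a b → IsVertex n a → IsVertex n b → ∃ λ ℓ → ℓ ≤ d × Walk p n a b ℓ

{-# OPTIONS --safe #-}
-- Write the vertices as 2i with 1 ≤ i ≤ n: then 2i and 2j are adjacent iff i + j and |i − j| are
-- both odd and either prime to 3 or equal to 3.  Sort i by its class (2 ∣ i, 3 ∣ i).  If i and j
-- lie in opposite classes (opposite parity, exactly one a multiple of 3) then i ± j is prime to 6,
-- so they are adjacent; for n ≥ 6 the vertices 1, 2, 3, 6 meet every class, so two vertices of the
-- same class have a common neighbour.  The remaining pairs are linked through the edges {k, k + 3}
-- with 3 ∤ k and the edge {1, 2}: every j prime to 3 has a neighbour of the other parity, still
-- prime to 3, and routing through it gives a walk of length at most 3.  For n ≤ 5 the only edges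
-- are 12, 14, 23, 25 and 34, and the pairs are checked directly.
module Submission where

open import Defs
open import Data.Bool using (Bool; true; false; not)
open import Data.Nat using (ℕ; zero; suc; _+_; _*_; _≤_; _<_; z≤n; s≤s; ⌊_/2⌋; ∣_-_∣; _≤?_)
open import Data.Nat.Properties
open import Data.Nat.Divisibility using (_∣_; _∤_; divides; _∣0; _∣?_; ∣-refl; ∣m∣n⇒∣m+n; ∣m+n∣m⇒∣n; ∣m∸n∣n⇒∣m)
open import Data.Nat.Coprimality using (coprime?; coprime-divisor)
open import Data.Product using (_×_; _,_; ∃; proj₁; proj₂; map₁)
open import Data.Sum using (_⊎_; inj₁; inj₂)
open import Function using (_∘_)
open import Function.Bundles using (_⇔_; mk⇔)
open import Relation.Binary.Definitions using (tri<; tri≈; tri>)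
open import Relation.Binary.PropositionalEquality using (_≡_; _≢_; refl; sym; trans; cong; cong₂; subst)
open import Relation.Nullary using (¬_; Dec; yes; no; does; contradiction)
open import Relation.Nullary.Decidable using (True; False; toWitness; toWitnessFalse; from-yes; from-no; does-⇔; ¬?)

variable
  A : Set
  a b c : ℕ
  d i j k m n p ℓ : ℕ

does≡false⇒¬ : (a? : Dec A) → does a? ≡ false → ¬ A
does≡false⇒¬ (no ¬a) _ = ¬a

∤-+ : d ∣ m → d ∤ n → d ∤ m + n
∤-+ d∣m d∤n d∣m+n = d∤n (∣m+n∣m⇒∣n d∣m+n d∣m)

∤-∣-∣ : d ∣ m → d ∤ n → d ∤ ∣ m - n ∣
∤-∣-∣ {d} {m} {n} d∣m d∤n d∣∣m-n∣ with ≤-total m n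
... | inj₁ m≤n = d∤n (∣m∸n∣n⇒∣m d m≤n (subst (d ∣_) (m≤n⇒∣m-n∣≡n∸m m≤n) d∣∣m-n∣) d∣m)
... | inj₂ n≤m = d∤n (∣m+n∣m⇒∣n (subst (d ∣_) (sym (m∸n+n≡m n≤m)) d∣m)
                                (subst (d ∣_) (m≤n⇒∣n-m∣≡n∸m n≤m) d∣∣m-n∣))

Separates : ℕ → ℕ → ℕ → Set
Separates d i j = (d ∣ i × d ∤ j) ⊎ (d ∤ i × d ∣ j)

separates-+ : Separates d i j → d ∤ i + j
separates-+ (inj₁ (d∣i , d∤j)) = ∤-+ d∣i d∤j
separates-+ {d} {i} {j} (inj₂ (d∤i , d∣j)) = ∤-+ d∣j d∤i ∘ subst (d ∣_) (+-comm i j)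

separates-∣-∣ : Separates d i j → d ∤ ∣ i - j ∣
separates-∣-∣ (inj₁ (d∣i , d∤j)) = ∤-∣-∣ d∣i d∤j
separates-∣-∣ {d} {i} {j} (inj₂ (d∤i , d∣j)) = ∤-∣-∣ d∣j d∤i ∘ subst (d ∣_) (∣-∣-comm i j)

separates⇒⇔ : Separates d i j → d ∣ i ⇔ d ∤ j
separates⇒⇔ (inj₁ (d∣i , d∤j)) = mk⇔ (λ _ → d∤j) (λ _ → d∣i)
separates⇒⇔ (inj₂ (d∤i , d∣j)) =
  mk⇔ (λ d∣i → contradiction d∣i d∤i) (λ d∤j → contradiction d∣j d∤j)

does-opposite⇒separates : ∀ d {i j} → does (d ∣? j) ≡ not (does (d ∣? i)) → Separates d i j
does-opposite⇒separates d {i} {j} eq with d ∣? i | d ∣? j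
does-opposite⇒separates d () | yes _   | yes _
... | yes d∣i | no d∤j  = inj₁ (d∣i , d∤j)
... | no d∤i  | yes d∣j = inj₂ (d∤i , d∣j)
does-opposite⇒separates d () | no _    | no _

∣k⇔∣d+k : d ∣ k ⇔ d ∣ d + k
∣k⇔∣d+k = mk⇔ (∣m∣n⇒∣m+n ∣-refl) (λ d∣d+k → ∣m+n∣m⇒∣n d∣d+k ∣-refl)

2∤⇒odd : 2 ∤ m → Odd m
2∤⇒odd {zero} 2∤0 = contradiction (2 ∣0) 2∤0
2∤⇒odd {suc zero} _ = 0 , refl
2∤⇒odd {suc (suc m)} 2∤2+m with k , refl ← 2∤⇒odd {m} (2∤2+m ∘ ∣m∣n⇒∣m+n ∣-refl) =
  suc k , cong suc (sym (*-suc 2 k))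

odd⇒2∣suc : Odd m → 2 ∣ suc m
odd⇒2∣suc (k , refl) = divides (suc k) (cong (2 +_) (*-comm 2 k))

separates-3+ : ∀ k → Separates 2 k (3 + k)
separates-3+ k with 2 ∣? k
... | yes 2∣k = inj₁ (2∣k , ∤-+ 2∣k (from-no (2 ∣? 3)) ∘ subst (2 ∣_) (+-comm 3 k))
... | no 2∤k  = inj₂ (2∤k , ∣m∣n⇒∣m+n ∣-refl (odd⇒2∣suc (2∤⇒odd 2∤k)))

3∤⇒3∤3+2* : 3 ∤ k → 3 ∤ 3 + 2 * k
3∤⇒3∤3+2* 3∤k 3∣3+2k =
  3∤k (coprime-divisor (from-yes (coprime? 3 2)) (∣m+n∣m⇒∣n 3∣3+2k ∣-refl))

badMultiple⇒∣ : BadMultiple p m → p ∣ m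
badMultiple⇒∣ {p} (k , _ , m≡p*k) = divides k (trans m≡p*k (*-comm p k))

allowed-if-coprime : 2 ∤ m → p ∤ m → Allowed p m
allowed-if-coprime 2∤m p∤m with odd@(_ , refl) ← 2∤⇒odd 2∤m = odd , s≤s z≤n , p∤m ∘ badMultiple⇒∣

allowed-self : Odd p → Allowed p p
allowed-self {p} odd@(_ , refl) =
  odd , s≤s z≤n , λ (k , 1<k , p≡p*k) → <⇒≢ (m<m*n p k 1<k) p≡p*k

allowed-3 : Allowed 3 3
allowed-3 = allowed-self (1 , refl)

allowed-if-coprime-to-6 : ∀ m {2∤m : False (2 ∣? m)} {3∤m : False (3 ∣? m)} → Allowed 3 m
allowed-if-coprime-to-6 m {2∤m} {3∤m} =
  allowed-if-coprime (toWitnessFalse 2∤m) (toWitnessFalse 3∤m)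

adj-sym : Adj p n a b → Adj p n b a
adj-sym {p} {a = a} {b} (va , vb , a≢b , sum , diff) =
  vb , va , a≢b ∘ sym ,
  subst (Allowed p ∘ ⌊_/2⌋) (+-comm a b) sum , subst (Allowed p ∘ ⌊_/2⌋) (∣-∣-comm a b) diff

adj-mono : m ≤ n → Adj p m a b → Adj p n a b
adj-mono m≤n ((i , 1≤i , i≤m , a≡2i) , (j , 1≤j , j≤m , b≡2j) , rest) =
  (i , 1≤i , ≤-trans i≤m m≤n , a≡2i) , (j , 1≤j , ≤-trans j≤m m≤n , b≡2j) , rest

walk-mono : m ≤ n → Walk p m a b ℓ → Walk p n a b ℓ
walk-mono m≤n here       = here
walk-mono {p = p} m≤n (step e w) = step (adj-mono {p = p} m≤n e) (walk-mono m≤n w)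

walk-snoc : Walk p n a b ℓ → Adj p n b c → Walk p n a c (suc ℓ)
walk-snoc here       e = step e here
walk-snoc (step e w) f = step e (walk-snoc w f)

walk-reverse : Walk p n a b ℓ → Walk p n b a ℓ
walk-reverse here       = here
walk-reverse {p = p} (step e w) = walk-snoc (walk-reverse w) (adj-sym {p = p} e)

InRange : ℕ → ℕ → Set
InRange n i = 1 ≤ i × i ≤ n

in-range : ∀ i {k} {1≤i : True (1 ≤? i)} {i≤k : True (i ≤? k)} → k ≤ n → InRange n i
in-range i {1≤i = 1≤i} {i≤k} k≤n = toWitness 1≤i , ≤-trans (toWitness i≤k) k≤n

-- Edge and Near are records rather than synonyms so that i and j can be inferred from their types:
-- unification cannot invert 2 * i.
record Edge (n i j : ℕ) : Set where
  constructor mk-edge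
  field adjacent : Adj 3 n (2 * i) (2 * j)

⌊2*n/2⌋≡n : ∀ n → ⌊ 2 * n /2⌋ ≡ n
⌊2*n/2⌋≡n zero    = refl
⌊2*n/2⌋≡n (suc n) = trans (cong (⌊_/2⌋ ∘ suc) (+-suc n (n + 0))) (cong suc (⌊2*n/2⌋≡n n))

edge : InRange n i → InRange n j → Allowed 3 (i + j) → Allowed 3 ∣ i - j ∣ → Edge n i j
edge {i = i} {j} (1≤i , i≤n) (1≤j , j≤n) sum diff = mk-edge
  ( (i , 1≤i , i≤n , refl) , (j , 1≤j , j≤n , refl) , 2i≢2j
  , subst (Allowed 3) (sym half-sum) sum , subst (Allowed 3) (sym half-diff) diff )
  where
  half-sum : ⌊ 2 * i + 2 * j /2⌋ ≡ i + j
  half-sum = trans (cong ⌊_/2⌋ (sym (*-distribˡ-+ 2 i j))) (⌊2*n/2⌋≡n (i + j))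
  half-diff : ⌊ ∣ 2 * i - 2 * j ∣ /2⌋ ≡ ∣ i - j ∣
  half-diff = trans (cong ⌊_/2⌋ (sym (*-distribˡ-∣-∣ 2 i j))) (⌊2*n/2⌋≡n ∣ i - j ∣)
  2i≢2j : 2 * i ≢ 2 * j
  2i≢2j 2i≡2j = <⇒≢ (proj₁ (proj₂ diff)) (sym (m≡n⇒∣m-n∣≡0 (*-cancelˡ-≡ i j 2 2i≡2j)))

edge-sym : Edge n i j → Edge n j i
edge-sym (mk-edge e) = mk-edge (adj-sym {p = 3} e)

record Near (n i j : ℕ) : Set where
  constructor mk-near
  field
    {length} : ℕ
    length≤3 : length ≤ 3
    walk     : Walk 3 n (2 * i) (2 * j) length

near-refl : Near n i i
near-refl = mk-near z≤n here

near-sym : Near n i j → Near n j i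
near-sym (mk-near ℓ≤3 w) = mk-near ℓ≤3 (walk-reverse w)

near-mono : m ≤ n → Near m i j → Near n i j
near-mono m≤n (mk-near ℓ≤3 w) = mk-near ℓ≤3 (walk-mono m≤n w)

path₁ : Edge n i j → Near n i j
path₁ (mk-edge e) = mk-near (s≤s z≤n) (step e here)

path₂ : Edge n i k → Edge n k j → Near n i j
path₂ (mk-edge e) (mk-edge f) = mk-near (s≤s (s≤s z≤n)) (step e (step f here))

path₃ : Edge n i k → Edge n k m → Edge n m j → Near n i j
path₃ (mk-edge e) (mk-edge f) (mk-edge g) = mk-near ≤-refl (step e (step f (step g here)))

Class : Set
Class = Bool × Bool

class : ℕ → Class
class m = does (2 ∣? m) , does (3 ∣? m)

opposite : Class → Class
opposite (e , t) = not e , not t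

variable
  β : Bool
  κ : Class

generic-edge : InRange n i → InRange n j → class i ≡ κ → class j ≡ opposite κ → Edge n i j
generic-edge {i = i} {j} ri rj refl cj =
  edge ri rj (allowed-if-coprime (separates-+ s₂) (separates-+ s₃))
             (allowed-if-coprime (separates-∣-∣ s₂) (separates-∣-∣ s₃))
  where
  s₂ = does-opposite⇒separates 2 {i} {j} (cong proj₁ cj)
  s₃ = does-opposite⇒separates 3 {i} {j} (cong proj₂ cj)

opposite-witness : 6 ≤ n → ∀ κ → ∃ λ w → InRange n w × class w ≡ opposite κ
opposite-witness 6≤n (true  , true ) = 1 , in-range 1 6≤n , refl
opposite-witness 6≤n (true  , false) = 3 , in-range 3 6≤n , refl
opposite-witness 6≤n (false , true ) = 2 , in-range 2 6≤n , refl
opposite-witness 6≤n (false , false) = 6 , in-range 6 6≤n , refl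

common-neighbour : 6 ≤ n → InRange n i → InRange n j → class i ≡ κ → class j ≡ κ →
                   ∃ λ w → Edge n i w × Edge n w j
common-neighbour {κ = κ} 6≤n ri rj ci cj =
  let w , rw , cw = opposite-witness 6≤n κ
  in w , generic-edge ri rw ci cw , edge-sym (generic-edge rj rw cj cw)

class-3+ : ∀ k → class k ≡ map₁ not (class (3 + k))
class-3+ k = cong₂ _,_ (does-⇔ (separates⇒⇔ (separates-3+ k)) (2 ∣? k) (¬? (2 ∣? 3 + k)))
                       (does-⇔ ∣k⇔∣d+k (3 ∣? k) (3 ∣? 3 + k))

partner : 2 ≤ n → InRange n j → class j ≡ (β , false) →
          ∃ λ k → InRange n k × class k ≡ (not β , false) × Edge n k j
partner {j = 1} 2≤n r refl =
  2 , in-range 2 2≤n , refl , edge (in-range 2 2≤n) r allowed-3 (allowed-if-coprime-to-6 1)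
partner {j = 2} 2≤n r refl =
  1 , in-range 1 2≤n , refl , edge (in-range 1 2≤n) r allowed-3 (allowed-if-coprime-to-6 1)
partner {j = 3} 2≤n r ()
partner {n} {j = suc (suc (suc k@(suc _)))} {β} 2≤n r@(_ , 3+k≤n) cj =
  k , rk , ck , edge rk r sum diff
  where
  rk : InRange n k
  rk = s≤s z≤n , ≤-trans (m≤n+m k 3) 3+k≤n
  ck : class k ≡ (not β , false)
  ck = trans (class-3+ k) (cong (map₁ not) cj)
  sum : Allowed 3 (k + (3 + k))
  sum = allowed-if-coprime (separates-+ (separates-3+ k))
          (3∤⇒3∤3+2* (does≡false⇒¬ (3 ∣? k) (cong proj₂ ck)) ∘ subst (3 ∣_) k+[3+k]≡3+2*k)
    where
    k+[3+k]≡3+2*k : k + (3 + k) ≡ 3 + 2 * k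
    k+[3+k]≡3+2*k = trans (+-comm k (3 + k)) (cong (λ x → 3 + (k + x)) (sym (+-identityʳ k)))
  diff : Allowed 3 ∣ k - 3 + k ∣
  diff = subst (Allowed 3) (sym (trans (m≤n⇒∣m-n∣≡n∸m (m≤n+m k 3)) (m+n∸n≡m 3 k))) allowed-3

module _ (6≤n : 6 ≤ n) where

  private
    2≤n : 2 ≤ n
    2≤n = ≤-trans (s≤s (s≤s z≤n)) 6≤n

  near-same-class : InRange n i → InRange n j → class i ≡ κ → class j ≡ κ → Near n i j
  near-same-class ri rj ci cj = let _ , e , f = common-neighbour 6≤n ri rj ci cj in path₂ e f

  near-same-parity : InRange n i → InRange n j → class i ≡ (β , true) → class j ≡ (β , false) →
                     Near n i j
  near-same-parity ri rj ci cj =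
    let _ , rk , ck , f = partner 2≤n rj cj in path₂ (generic-edge ri rk ci ck) f

  near-coprime-to-3 : InRange n i → InRange n j → class i ≡ (not β , false) → class j ≡ (β , false) →
                      Near n i j
  near-coprime-to-3 ri rj ci cj =
    let _ , rk , ck , g = partner 2≤n rj cj
        _ , e , f       = common-neighbour 6≤n ri rk ci ck
    in path₃ e f g

  near-multiples-of-3 : InRange n i → InRange n j → class i ≡ (not β , true) → class j ≡ (β , true) →
                        Near n i j
  near-multiples-of-3 {β = β} ri rj ci cj =
    let _ , rw , cw     = opposite-witness 6≤n (β , true)
        _ , rk , ck , f = partner 2≤n rw cw
    in path₃ (generic-edge ri rk ci ck) f (edge-sym (generic-edge rj rw cj cw))

  near-large : InRange n i → InRange n j → Near n i j
  near-large {i} {j} ri rj with class i in ci | class j in cj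
  ... | true  , true  | true  , true  = near-same-class ri rj ci cj
  ... | true  , true  | true  , false = near-same-parity ri rj ci cj
  ... | true  , true  | false , true  = near-multiples-of-3 ri rj ci cj
  ... | true  , true  | false , false = path₁ (generic-edge ri rj ci cj)
  ... | true  , false | true  , true  = near-sym (near-same-parity rj ri cj ci)
  ... | true  , false | true  , false = near-same-class ri rj ci cj
  ... | true  , false | false , true  = path₁ (generic-edge ri rj ci cj)
  ... | true  , false | false , false = near-coprime-to-3 ri rj ci cj
  ... | false , true  | true  , true  = near-multiples-of-3 ri rj ci cj
  ... | false , true  | true  , false = path₁ (generic-edge ri rj ci cj)
  ... | false , true  | false , true  = near-same-class ri rj ci cj
  ... | false , true  | false , false = near-same-parity ri rj ci cj
  ... | false , false | true  , true  = path₁ (generic-edge ri rj ci cj)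
  ... | false , false | true  , false = near-coprime-to-3 ri rj ci cj
  ... | false , false | false , true  = near-sym (near-same-parity rj ri cj ci)
  ... | false , false | false , false = near-same-class ri rj ci cj

edge₁₂ : Edge (2 + n) 1 2
edge₁₂ {n} = edge (in-range 1 (m≤m+n 2 n)) (in-range 2 (m≤m+n 2 n))
                  allowed-3 (allowed-if-coprime-to-6 1)

edge₂₃ : Edge (3 + n) 2 3
edge₂₃ {n} = edge (in-range 2 (m≤m+n 3 n)) (in-range 3 (m≤m+n 3 n))
                  (allowed-if-coprime-to-6 5) (allowed-if-coprime-to-6 1)

edge₁₄ : Edge (4 + n) 1 4
edge₁₄ {n} = edge (in-range 1 (m≤m+n 4 n)) (in-range 4 (m≤m+n 4 n))
                  (allowed-if-coprime-to-6 5) allowed-3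

edge₃₄ : Edge (4 + n) 3 4
edge₃₄ {n} = edge (in-range 3 (m≤m+n 4 n)) (in-range 4 (m≤m+n 4 n))
                  (allowed-if-coprime-to-6 7) (allowed-if-coprime-to-6 1)

edge₂₅ : Edge (5 + n) 2 5
edge₂₅ {n} = edge (in-range 2 (m≤m+n 5 n)) (in-range 5 (m≤m+n 5 n))
                  (allowed-if-coprime-to-6 7) allowed-3

near-ordered-below-6 : ∀ i j → 1 ≤ i → i < j → j ≤ 5 → Near j i j
near-ordered-below-6 1 2 _ _ _ = path₁ edge₁₂
near-ordered-below-6 1 3 _ _ _ = path₂ edge₁₂ edge₂₃
near-ordered-below-6 1 4 _ _ _ = path₁ edge₁₄
near-ordered-below-6 1 5 _ _ _ = path₂ edge₁₂ edge₂₅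
near-ordered-below-6 2 3 _ _ _ = path₁ edge₂₃
near-ordered-below-6 2 4 _ _ _ = path₂ edge₂₃ edge₃₄
near-ordered-below-6 2 5 _ _ _ = path₁ edge₂₅
near-ordered-below-6 3 4 _ _ _ = path₁ edge₃₄
near-ordered-below-6 3 5 _ _ _ = path₂ (edge-sym edge₂₃) edge₂₅
near-ordered-below-6 4 5 _ _ _ = path₃ (edge-sym edge₁₄) edge₁₂ edge₂₅
near-ordered-below-6 0 _ () _ _
near-ordered-below-6 _ (suc (suc (suc (suc (suc (suc _)))))) _ _ (s≤s (s≤s (s≤s (s≤s (s≤s ())))))
near-ordered-below-6 (suc _) 1 _ (s≤s ()) _
near-ordered-below-6 (suc (suc _)) 2 _ (s≤s (s≤s ())) _
near-ordered-below-6 (suc (suc (suc _))) 3 _ (s≤s (s≤s (s≤s ()))) _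
near-ordered-below-6 (suc (suc (suc (suc _)))) 4 _ (s≤s (s≤s (s≤s (s≤s ())))) _
near-ordered-below-6 (suc (suc (suc (suc (suc _))))) 5 _ (s≤s (s≤s (s≤s (s≤s (s≤s ()))))) _

near-small : n ≤ 5 → InRange n i → InRange n j → Near n i j
near-small {i = i} {j} n≤5 (1≤i , i≤n) (1≤j , j≤n) with <-cmp i j
... | tri< i<j _ _ = near-mono j≤n (near-ordered-below-6 i j 1≤i i<j (≤-trans j≤n n≤5))
... | tri≈ _ refl _ = near-refl
... | tri> _ _ j<i = near-sym (near-mono i≤n (near-ordered-below-6 j i 1≤j j<i (≤-trans i≤n n≤5)))

near : InRange n i → InRange n j → Near n i j
near {n} with 6 ≤? n
... | yes 6≤n = near-large 6≤n
... | no  6≰n = near-small (≤-pred (≰⇒> 6≰n))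

theorem4p1 : (n : ℕ) → Connected 3 n × DiameterAtMost 3 n 3
theorem4p1 n = connected , diameter
  where
  diameter : DiameterAtMost 3 n 3
  diameter _ _ (i , 1≤i , i≤n , refl) (j , 1≤j , j≤n , refl) =
    let mk-near ℓ≤3 w = near (1≤i , i≤n) (1≤j , j≤n) in _ , ℓ≤3 , w
  connected : Connected 3 n
  connected a b va vb = let ℓ , _ , w = diameter a b va vb in ℓ , w
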